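{- Let $G$ be a strongly connected graph and let $v,w\in V(G)$. If $w$ is simple, then the Laplacian matrix $Q(G)$ is equivalent (over $\mathbf{Z}$) to the matrix $Q'$ obtained from $Q(G)$ by replacing every entry in column $v$ and every entry in row $w$ by zero.
   Context: A graph is a finite directed multigraph. $A$ is the $V\times V$ matrix with $A_{vw}$ the number of directed edges from $v$ to $w$, $\Delta$ is diagonal with $\Delta_{vv}=\sum_wA_{vw}$, and $Q(G)=\Delta-A$. Two square integer matrices $M,M'$ are equivalent if $LMN=M'$ for some integer matrices $L,N$ of determinant $\pm1$. For strongly connected $G$, the activity vector $\mathbf{h}$ is the unique vector with positive integer entries, gcd of entries $1$, and $Q^{\dagger}\mathbf{h}=\mathbf{0}$ ($\dagger$ = transpose); a vertex $w$ is simple if $h(w)=1$. -}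

module Defs where

open import Data.Nat as ℕ using (ℕ; zero; suc)
open import Data.Nat.GCD using (gcd)
open import Data.Integer as ℤ using (ℤ; +_; -_; _-_)
open import Data.Fin using (Fin; zero; suc; toℕ; punchIn; _≟_)
open import Data.Product using (Σ; _×_; _,_)
open import Data.Sum using (_⊎_)
open import Relation.Nullary using (yes; no)
open import Relation.Binary.PropositionalEquality using (_≡_)

-- A (finite directed multi)graph on vertex set Fin n: adjacency matrix,
-- A u x = number of directed edges from u to x.
Graph : ℕ → Set
Graph n = Fin n → Fin n → ℕ

Matrix : ℕ → Set
Matrix n = Fin n → Fin n → ℤ

Σℤ : ∀ {n} → (Fin n → ℤ) → ℤ
Σℤ {zero}  f = + 0
Σℤ {suc n} f = f zero ℤ.+ Σℤ (λ i → f (suc i))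

Σℕ : ∀ {n} → (Fin n → ℕ) → ℕ
Σℕ {zero}  f = 0
Σℕ {suc n} f = f zero ℕ.+ Σℕ (λ i → f (suc i))

gcdAll : ∀ {n} → (Fin n → ℕ) → ℕ
gcdAll {zero}  f = 0
gcdAll {suc n} f = gcd (f zero) (gcdAll (λ i → f (suc i)))

_⊗_ : ∀ {n} → Matrix n → Matrix n → Matrix n
(M ⊗ N) i k = Σℤ (λ j → M i j ℤ.* N j k)

det : ∀ {n} → Matrix n → ℤ
det {zero}  M = + 1
det {suc n} M =
  Σℤ (λ j → sgn (toℕ j) ℤ.* (M zero j ℤ.* det (λ r c → M (suc r) (punchIn j c))))
  where
  sgn : ℕ → ℤ
  sgn zero = + 1
  sgn (suc k) = - sgn k

Unimodular : ∀ {n} → Matrix n → Set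
Unimodular M = det M ≡ + 1 ⊎ det M ≡ - (+ 1)

Equivalent : ∀ {n} → Matrix n → Matrix n → Set
Equivalent {n} M M' =
  Σ (Matrix n) λ L → Σ (Matrix n) λ N →
    Unimodular L × Unimodular N × (∀ i j → ((L ⊗ M) ⊗ N) i j ≡ M' i j)

δ : ∀ {n} → Fin n → Fin n → ℤ
δ i j with i ≟ j
... | yes _ = + 1
... | no _  = + 0

laplacian : ∀ {n} → Graph n → Matrix n
laplacian A i j = (δ i j ℤ.* (+ Σℕ (A i))) - (+ A i j)

data Reach {n} (A : Graph n) (u : Fin n) : Fin n → Set where
  here : Reach A u u
  step : ∀ {y z} → Reach A u y → 1 ℕ.≤ A y z → Reach A u z

StronglyConnected : ∀ {n} → Graph n → Set
StronglyConnected {n} A = ∀ (u x : Fin n) → Reach A u x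

IsActivityVector : ∀ {n} → Graph n → (Fin n → ℕ) → Set
IsActivityVector A h =
  (∀ i → 1 ℕ.≤ h i) × gcdAll h ≡ 1 ×
  (∀ j → Σℤ (λ i → laplacian A i j ℤ.* (+ h i)) ≡ + 0)

Simple : ∀ {n} → Graph n → Fin n → Set
Simple {n} A w = Σ (Fin n → ℕ) λ h → IsActivityVector A h × h w ≡ 1

zeroColRow : ∀ {n} → Matrix n → Fin n → Fin n → Matrix n
zeroColRow M v w i j with j ≟ v | i ≟ w
... | yes _ | _     = + 0
... | no _  | yes _ = + 0
... | no _  | no _  = M i j

-- Let h be the activity vector, with h(w) = 1. Left multiplication by the identity
-- matrix with row w replaced by hᵀ has determinant h(w) = 1 and, since hᵀQ = 0, only
-- turns row w of Q into zero. Right multiplication by the identity matrix with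
-- column v replaced by all ones has determinant 1 and only replaces column v by
-- the row sums, which vanish: the rows of Q sum to zero (Q𝟙 = 0) and row w is zero.
{-# OPTIONS --safe #-}
module Submission where

open import Defs
open import Data.Nat using (ℕ; zero; suc)
open import Data.Fin using (Fin; zero; suc; punchIn; _≟_)
open import Data.Fin.Properties using (suc-injective; punchInᵢ≢i)
open import Data.Integer using (ℤ; +_; _-_; _+_; _*_; sign)
open import Data.Integer.Properties
  using (+-identityˡ; +-identityʳ; +-inverseʳ; *-identityˡ; *-identityʳ; *-zeroʳ; *-comm)
open import Data.Integer.Tactic.RingSolver using (solve-∀)
open import Data.Product using (∃; _,_)
open import Data.Sum using (inj₁)
open import Function using (_∘_)
open import Relation.Nullary using (Dec; yes; no; contradiction)
open import Relation.Binary.PropositionalEquality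
  using (_≡_; _≢_; refl; sym; trans; cong; cong₂; module ≡-Reasoning)

private
  variable
    n : ℕ

j≡0⇒i*j≡0 : ∀ i {j} → j ≡ + 0 → i * j ≡ + 0
j≡0⇒i*j≡0 i refl = *-zeroʳ i

δ-refl : (i : Fin n) → δ i i ≡ + 1
δ-refl i with i ≟ i
... | yes _   = refl
... | no i≢i = contradiction refl i≢i

δ-≢ : {i j : Fin n} → i ≢ j → δ i j ≡ + 0
δ-≢ {i = i} {j} i≢j with i ≟ j
... | yes i≡j = contradiction i≡j i≢j
... | no _    = refl

δ-suc : (i j : Fin n) → δ (suc i) (suc j) ≡ δ i j
δ-suc i j = by-cases (i ≟ j)
  where
  by-cases : Dec (i ≡ j) → δ (suc i) (suc j) ≡ δ i j
  by-cases (yes refl) = trans (δ-refl (suc i)) (sym (δ-refl i))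
  by-cases (no i≢j)   = trans (δ-≢ (i≢j ∘ suc-injective)) (sym (δ-≢ i≢j))

Σℤ-cong : {f g : Fin n → ℤ} → (∀ j → f j ≡ g j) → Σℤ f ≡ Σℤ g
Σℤ-cong {zero}  f≡g = refl
Σℤ-cong {suc n} f≡g = cong₂ _+_ (f≡g zero) (Σℤ-cong (f≡g ∘ suc))

Σℤ-zero : {f : Fin n → ℤ} → (∀ j → f j ≡ + 0) → Σℤ f ≡ + 0
Σℤ-zero {zero}  f≡0 = refl
Σℤ-zero {suc n} f≡0 = cong₂ _+_ (f≡0 zero) (Σℤ-zero (f≡0 ∘ suc))

Σℤ-single : {f : Fin n → ℤ} (k : Fin n) → (∀ j → j ≢ k → f j ≡ + 0) → Σℤ f ≡ f k
Σℤ-single {suc n} {f} zero    f≡0 =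
  trans (cong (_+_ (f zero)) (Σℤ-zero (λ j → f≡0 (suc j) λ ())))
        (+-identityʳ (f zero))
Σℤ-single {suc n} {f} (suc k) f≡0 =
  trans (cong₂ _+_ (f≡0 zero λ ())
                   (Σℤ-single k (λ j j≢k → f≡0 (suc j) (j≢k ∘ suc-injective))))
        (+-identityˡ (f (suc k)))

Σℤ-distrib-minus : (f g : Fin n → ℤ) → Σℤ (λ j → f j - g j) ≡ Σℤ f - Σℤ g
Σℤ-distrib-minus {zero}  f g = refl
Σℤ-distrib-minus {suc n} f g =
  trans (cong (_+_ (f zero - g zero)) (Σℤ-distrib-minus (f ∘ suc) (g ∘ suc)))
        (interchange (f zero) (g zero) (Σℤ (f ∘ suc)) (Σℤ (g ∘ suc)))
  where
  interchange : ∀ a b c d → (a - b) + (c - d) ≡ (a + c) - (b + d)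
  interchange = solve-∀

Σℤ-+ : (f : Fin n → ℕ) → Σℤ (λ j → + f j) ≡ + Σℕ f
Σℤ-+ {zero}  f = refl
Σℤ-+ {suc n} f = cong (_+_ (+ f zero)) (Σℤ-+ (f ∘ suc))

Σℤ-δˡ : (i : Fin n) (f : Fin n → ℤ) → Σℤ (λ j → δ i j * f j) ≡ f i
Σℤ-δˡ i f =
  trans (Σℤ-single i (λ j j≢i → cong (_* f j) (δ-≢ (j≢i ∘ sym))))
        (trans (cong (_* f i) (δ-refl i)) (*-identityˡ (f i)))

Σℤ-δʳ : (k : Fin n) (f : Fin n → ℤ) → Σℤ (λ j → f j * δ j k) ≡ f k
Σℤ-δʳ k f =
  trans (Σℤ-single k (λ j j≢k → j≡0⇒i*j≡0 (f j) (δ-≢ j≢k)))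
        (trans (cong (f k *_) (δ-refl k)) (*-identityʳ (f k)))

minor : Matrix (suc n) → Fin (suc n) → Matrix n
minor M j r c = M (suc r) (punchIn j c)

-- The signs of det come from a function local to its where block; abstracting
-- sign keeps _*_ from unfolding, so that unification can read them off.
det-expand : (M : Matrix (suc n)) → ∃ λ (signs : Fin n → ℤ) →
  det M ≡ + 1 * (M zero zero * det (minor M zero))
          + Σℤ (λ i → signs i * (M zero (suc i) * det (minor M (suc i))))
det-expand M with sign
... | _ = _ , refl

det-expand-head : (M : Matrix (suc n)) →
  (∀ i → M zero (suc i) * det (minor M (suc i)) ≡ + 0) →
  det M ≡ M zero zero * det (minor M zero)
det-expand-head M tail≡0 with det-expand M
... | signs , expansion = begin
  det M                                     ≡⟨ expansion ⟩
  + 1 * head + Σℤ (λ i → signs i * tail i)  ≡⟨ cong₂ _+_ (*-identityˡ head)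
                                                         (Σℤ-zero signed-tail≡0) ⟩
  head + + 0                                ≡⟨ +-identityʳ head ⟩
  head                                      ∎
  where
  open ≡-Reasoning
  head = M zero zero * det (minor M zero)
  tail = λ i → M zero (suc i) * det (minor M (suc i))
  signed-tail≡0 : ∀ i → signs i * tail i ≡ + 0
  signed-tail≡0 i = j≡0⇒i*j≡0 (signs i) (tail≡0 i)

det-zeroRow : (M : Matrix n) (r : Fin n) → (∀ c → M r c ≡ + 0) → det M ≡ + 0
det-zeroRow M zero row≡0 =
  trans (det-expand-head M (λ i → cong (_* det (minor M (suc i))) (row≡0 (suc i))))
        (cong (_* det (minor M zero)) (row≡0 zero))
det-zeroRow M (suc r) row≡0 =
  trans (det-expand-head M (λ i → j≡0⇒i*j≡0 (M zero (suc i))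
                                    (det-zeroRow (minor M (suc i)) r (row≡0 ∘ punchIn (suc i)))))
        (j≡0⇒i*j≡0 (M zero zero) (det-zeroRow (minor M zero) r (row≡0 ∘ suc)))

det-zeroCol₀ : (M : Matrix (suc n)) → (∀ r → M r zero ≡ + 0) → det M ≡ + 0
det-zeroCol₀ {zero}  M col≡0 =
  trans (det-expand-head M λ ()) (cong (_* det (minor M zero)) (col≡0 zero))
det-zeroCol₀ {suc n} M col≡0 =
  trans (det-expand-head M (λ i → j≡0⇒i*j≡0 (M zero (suc i))
                                    (det-zeroCol₀ (minor M (suc i)) (col≡0 ∘ suc))))
        (cong (_* det (minor M zero)) (col≡0 zero))

det-identity : (M : Matrix n) → (∀ i j → M i j ≡ δ i j) → det M ≡ + 1
det-identity {zero}  M M≡I = refl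
det-identity {suc n} M M≡I =
  trans (det-expand-head M (λ i → cong (_* det (minor M (suc i))) (M≡I zero (suc i))))
        (cong₂ _*_ (M≡I zero zero)
                   (det-identity (minor M zero) (λ i j → trans (M≡I (suc i) (suc j)) (δ-suc i j))))

det-minor₀-identity : (M : Matrix (suc n)) →
  (∀ i j → M (suc i) (suc j) ≡ δ (suc i) (suc j)) → det (minor M zero) ≡ + 1
det-minor₀-identity M M≡I = det-identity (minor M zero) (λ i j → trans (M≡I i j) (δ-suc i j))

det-identityOffRow : (M : Matrix n) (w : Fin n) →
  (∀ i j → i ≢ w → M i j ≡ δ i j) → det M ≡ M w w
det-identityOffRow M zero M≡I =
  trans (det-expand-head M (λ i → j≡0⇒i*j≡0 (M zero (suc i))
                                    (det-zeroRow (minor M (suc i)) i (minor-row≡0 i))))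
        (trans (cong (M zero zero *_) (det-minor₀-identity M (λ i j → M≡I (suc i) (suc j) λ ())))
               (*-identityʳ (M zero zero)))
  where
  minor-row≡0 : ∀ i c → M (suc i) (punchIn (suc i) c) ≡ + 0
  minor-row≡0 i c =
    trans (M≡I (suc i) (punchIn (suc i) c) λ ()) (δ-≢ (punchInᵢ≢i (suc i) c ∘ sym))
det-identityOffRow M (suc w) M≡I =
  trans (det-expand-head M (λ i → cong (_* det (minor M (suc i))) (M≡I zero (suc i) λ ())))
        (trans (cong₂ _*_ (M≡I zero zero λ ())
                          (det-identityOffRow (minor M zero) w
                            (λ i j i≢w → trans (M≡I (suc i) (suc j) (i≢w ∘ suc-injective))
                                               (δ-suc i j))))
               (*-identityˡ (M (suc w) (suc w))))

det-identityOffCol : (M : Matrix n) (v : Fin n) →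
  (∀ i j → j ≢ v → M i j ≡ δ i j) → det M ≡ M v v
det-identityOffCol M zero M≡I =
  trans (det-expand-head M (λ i → cong (_* det (minor M (suc i))) (M≡I zero (suc i) λ ())))
        (trans (cong (M zero zero *_) (det-minor₀-identity M (λ i j → M≡I (suc i) (suc j) λ ())))
               (*-identityʳ (M zero zero)))
det-identityOffCol {suc (suc n)} M (suc v) M≡I =
  trans (det-expand-head M (λ i → j≡0⇒i*j≡0 (M zero (suc i))
                                    (det-zeroCol₀ (minor M (suc i))
                                                  (λ r → M≡I (suc r) zero λ ()))))
        (trans (cong₂ _*_ (M≡I zero zero λ ())
                          (det-identityOffCol (minor M zero) v
                            (λ i j j≢v → trans (M≡I (suc i) (suc j) (j≢v ∘ suc-injective))
                                               (δ-suc i j))))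
               (*-identityˡ (M (suc v) (suc v))))

identityWithRow : Fin n → (Fin n → ℤ) → Matrix n
identityWithRow w r i j with i ≟ w
... | yes _ = r j
... | no _  = δ i j

identityWithRow-≡ : (w : Fin n) (r : Fin n → ℤ) (j : Fin n) → identityWithRow w r w j ≡ r j
identityWithRow-≡ w r j with w ≟ w
... | yes _   = refl
... | no w≢w = contradiction refl w≢w

identityWithRow-≢ : {w i : Fin n} (r : Fin n → ℤ) (j : Fin n) →
  i ≢ w → identityWithRow w r i j ≡ δ i j
identityWithRow-≢ {w = w} {i} r j i≢w with i ≟ w
... | yes i≡w = contradiction i≡w i≢w
... | no _    = refl

identityWithCol : Fin n → (Fin n → ℤ) → Matrix n
identityWithCol v c i j with j ≟ v
... | yes _ = c i
... | no _  = δ i j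

identityWithCol-≡ : (v : Fin n) (c : Fin n → ℤ) (i : Fin n) → identityWithCol v c i v ≡ c i
identityWithCol-≡ v c i with v ≟ v
... | yes _   = refl
... | no v≢v = contradiction refl v≢v

identityWithCol-≢ : {v j : Fin n} (c : Fin n → ℤ) (i : Fin n) →
  j ≢ v → identityWithCol v c i j ≡ δ i j
identityWithCol-≢ {v = v} {j} c i j≢v with j ≟ v
... | yes j≡v = contradiction j≡v j≢v
... | no _    = refl

det-identityWithRow : (w : Fin n) (r : Fin n → ℤ) → det (identityWithRow w r) ≡ r w
det-identityWithRow w r =
  trans (det-identityOffRow _ w (λ i j → identityWithRow-≢ r j)) (identityWithRow-≡ w r w)

det-identityWithCol : (v : Fin n) (c : Fin n → ℤ) → det (identityWithCol v c) ≡ c v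
det-identityWithCol v c =
  trans (det-identityOffCol _ v (λ i j → identityWithCol-≢ c i)) (identityWithCol-≡ v c v)

identityWithRow-⊗-≡ : (w : Fin n) (r : Fin n → ℤ) (M : Matrix n) (k : Fin n) →
  (identityWithRow w r ⊗ M) w k ≡ Σℤ (λ j → r j * M j k)
identityWithRow-⊗-≡ w r M k = Σℤ-cong (λ j → cong (_* M j k) (identityWithRow-≡ w r j))

identityWithRow-⊗-≢ : {w i : Fin n} (r : Fin n → ℤ) (M : Matrix n) (k : Fin n) →
  i ≢ w → (identityWithRow w r ⊗ M) i k ≡ M i k
identityWithRow-⊗-≢ {i = i} r M k i≢w =
  trans (Σℤ-cong (λ j → cong (_* M j k) (identityWithRow-≢ r j i≢w)))
        (Σℤ-δˡ i (λ j → M j k))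

⊗-identityWithCol-≡ : (v : Fin n) (c : Fin n → ℤ) (M : Matrix n) (i : Fin n) →
  (M ⊗ identityWithCol v c) i v ≡ Σℤ (λ j → M i j * c j)
⊗-identityWithCol-≡ v c M i = Σℤ-cong (λ j → cong (M i j *_) (identityWithCol-≡ v c j))

⊗-identityWithCol-≢ : {v k : Fin n} (c : Fin n → ℤ) (M : Matrix n) (i : Fin n) →
  k ≢ v → (M ⊗ identityWithCol v c) i k ≡ M i k
⊗-identityWithCol-≢ {k = k} c M i k≢v =
  trans (Σℤ-cong (λ j → cong (M i j *_) (identityWithCol-≢ c j k≢v))) (Σℤ-δʳ k (M i))

module _ (M : Matrix n) (r : Fin n → ℤ) (rᵀM≡0 : ∀ k → Σℤ (λ j → r j * M j k) ≡ + 0) where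

  identityWithRow-⊗-row≡0 : (w k : Fin n) → (identityWithRow w r ⊗ M) w k ≡ + 0
  identityWithRow-⊗-row≡0 w k = trans (identityWithRow-⊗-≡ w r M k) (rᵀM≡0 k)

  identityWithRow-⊗-rowSum≡0 : (∀ i → Σℤ (M i) ≡ + 0) →
    (w i : Fin n) → Σℤ ((identityWithRow w r ⊗ M) i) ≡ + 0
  identityWithRow-⊗-rowSum≡0 rowSum≡0 w i = by-cases (i ≟ w)
    where
    by-cases : Dec (i ≡ w) → Σℤ ((identityWithRow w r ⊗ M) i) ≡ + 0
    by-cases (yes refl) = Σℤ-zero (identityWithRow-⊗-row≡0 w)
    by-cases (no i≢w)   =
      trans (Σℤ-cong (λ k → identityWithRow-⊗-≢ r M k i≢w)) (rowSum≡0 i)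

laplacian-rowSum≡0 : (A : Graph n) (i : Fin n) → Σℤ (laplacian A i) ≡ + 0
laplacian-rowSum≡0 A i = begin
  Σℤ (λ j → δ i j * outdeg - + A i j)
    ≡⟨ Σℤ-distrib-minus (λ j → δ i j * outdeg) (λ j → + A i j) ⟩
  Σℤ (λ j → δ i j * outdeg) - Σℤ (λ j → + A i j)
    ≡⟨ cong₂ _-_ (Σℤ-δˡ i (λ _ → outdeg)) (Σℤ-+ (A i)) ⟩
  outdeg - outdeg
    ≡⟨ +-inverseʳ outdeg ⟩
  + 0
    ∎
  where
  open ≡-Reasoning
  outdeg = + Σℕ (A i)

zeroColRow-unique : (M M′ : Matrix n) (v w : Fin n) →
  (∀ i → M′ i v ≡ + 0) → (∀ k → k ≢ v → M′ w k ≡ + 0) →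
  (∀ i k → k ≢ v → i ≢ w → M′ i k ≡ M i k) →
  ∀ i k → M′ i k ≡ zeroColRow M v w i k
zeroColRow-unique M M′ v w col≡0 row≡0 rest≡M i k with k ≟ v | i ≟ w
... | yes refl | _        = col≡0 i
... | no k≢v   | yes refl = row≡0 k k≢v
... | no k≢v   | no i≢w   = rest≡M i k k≢v i≢w

-- Strong connectivity only guarantees that the activity vector exists; Simple supplies it.
lemma7p1 : ∀ (n : ℕ) (A : Graph n) (v w : Fin n) →
    StronglyConnected A → Simple A w →
    Equivalent (laplacian A) (zeroColRow (laplacian A) v w)
lemma7p1 n A v w _ (h , (_ , _ , Qᵀh≡0) , hw≡1) =
  L , N , inj₁ (trans (det-identityWithRow w h′) (cong +_ hw≡1)) ,
  inj₁ (det-identityWithCol v 𝟙) ,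
  zeroColRow-unique Q ((L ⊗ Q) ⊗ N) v w col-v≡0 row-w≡0 rest≡Q
  where
  Q = laplacian A
  h′ = λ i → + h i
  𝟙 = λ (_ : Fin n) → + 1
  L = identityWithRow w h′
  N = identityWithCol v 𝟙

  hᵀQ≡0 : ∀ k → Σℤ (λ j → h′ j * Q j k) ≡ + 0
  hᵀQ≡0 k = trans (Σℤ-cong (λ j → *-comm (h′ j) (Q j k))) (Qᵀh≡0 k)

  col-v≡0 : ∀ i → ((L ⊗ Q) ⊗ N) i v ≡ + 0
  col-v≡0 i = trans (⊗-identityWithCol-≡ v 𝟙 (L ⊗ Q) i)
                    (trans (Σℤ-cong (λ j → *-identityʳ ((L ⊗ Q) i j)))
                           (identityWithRow-⊗-rowSum≡0 Q h′ hᵀQ≡0 (laplacian-rowSum≡0 A) w i))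

  row-w≡0 : ∀ k → k ≢ v → ((L ⊗ Q) ⊗ N) w k ≡ + 0
  row-w≡0 k k≢v =
    trans (⊗-identityWithCol-≢ 𝟙 (L ⊗ Q) w k≢v) (identityWithRow-⊗-row≡0 Q h′ hᵀQ≡0 w k)

  rest≡Q : ∀ i k → k ≢ v → i ≢ w → ((L ⊗ Q) ⊗ N) i k ≡ Q i k
  rest≡Q i k k≢v i≢w =
    trans (⊗-identityWithCol-≢ 𝟙 (L ⊗ Q) i k≢v) (identityWithRow-⊗-≢ h′ Q k i≢w)
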